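{- Let $G=G(A,B)$ be an irreducible graph with respect to a hereditary class $\mathcal{X}\subseteq Free(\{P_3+P_2\})$. For any three vertices $a_1,a_2,a_3\in A$ with $a_1a_2\in E(G)$, $a_1a_3\notin E(G)$, $a_2a_3\notin E(G)$, we have $N_B(a_3)\subseteq N_B(a_1)\cup N_B(a_2)$. Moreover, if $D$ is an inclusion-minimal subset of $A$ dominating $B$, then $G[D]$ is a complete multipartite graph.
   Context: $P_3+P_2$ is the disjoint union of paths on 3 and 2 vertices; $Free(\mathcal{F})$ is the class of graphs with no induced subgraph isomorphic to a member of $\mathcal{F}$; a class is hereditary if closed under vertex deletion. A graph $G$ with a partition $V(G)=A\cup B$ (written $G(A,B)$) is irreducible with respect to $\mathcal{X}$ if: $G\in\mathcal{X}$; $B$ is independent; no vertex of $B$ has degree one; there are no two distinct $u,v\in A$ with $N(u)\setminus A\subseteq N(v)\setminus A$; no vertex of $B$ is adjacent to all vertices of $A$; and $A$ is partitioned into (possibly empty) sets $A_1,A_2,A_3$ such that adding two new vertices $x,y$ and all edges $xx'$ for $x'\in A_1\cup A_3$ and $yy'$ for $y'\in A_2\cup A_3$ yields a graph $G'\in\mathcal{X}$. $N_B(a)=N(a)\cap B$. A subset $D\subseteq A$ dominates $B$ if every vertex of $B$ has a neighbor in $D$. -}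

module Defs where

open import Data.Nat using (ℕ; zero; suc)
open import Data.Fin using (Fin; zero; suc)
open import Data.Bool using (Bool; true; false; _∧_; _∨_)
open import Data.Product using (Σ; ∃; _×_; _,_)
open import Data.Sum using (_⊎_)
open import Relation.Nullary using (¬_)
open import Relation.Binary.PropositionalEquality using (_≡_; _≢_; refl)
open import Function.Definitions using (Injective)

record Graph : Set where
  field
    n      : ℕ
    adj    : Fin n → Fin n → Bool
    sym    : ∀ u v → adj u v ≡ adj v u
    irrefl : ∀ u → adj u u ≡ false
open Graph public

record _⊑_ (H G : Graph) : Set where
  field
    emb     : Fin (n H) → Fin (n G)
    inj     : Injective _≡_ _≡_ emb
    adj-pres : ∀ u v → adj H u v ≡ adj G (emb u) (emb v)

GraphClass : Set₁
GraphClass = Graph → Set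

Hereditary : GraphClass → Set
Hereditary 𝒳 = ∀ G H → 𝒳 G → H ⊑ G → 𝒳 H

-- The graph P3 + P2 on vertices 0..4: edges 0-1, 1-2, 3-4.
p32 : Fin 5 → Fin 5 → Bool
p32 zero (suc zero) = true
p32 (suc zero) zero = true
p32 (suc zero) (suc (suc zero)) = true
p32 (suc (suc zero)) (suc zero) = true
p32 (suc (suc (suc zero))) (suc (suc (suc (suc zero)))) = true
p32 (suc (suc (suc (suc zero)))) (suc (suc (suc zero))) = true
p32 _ _ = false

p32-sym : ∀ u v → p32 u v ≡ p32 v u
p32-sym zero zero = refl
p32-sym zero (suc zero) = refl
p32-sym zero (suc (suc zero)) = refl
p32-sym zero (suc (suc (suc zero))) = refl
p32-sym zero (suc (suc (suc (suc zero)))) = refl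
p32-sym (suc zero) zero = refl
p32-sym (suc zero) (suc zero) = refl
p32-sym (suc zero) (suc (suc zero)) = refl
p32-sym (suc zero) (suc (suc (suc zero))) = refl
p32-sym (suc zero) (suc (suc (suc (suc zero)))) = refl
p32-sym (suc (suc zero)) zero = refl
p32-sym (suc (suc zero)) (suc zero) = refl
p32-sym (suc (suc zero)) (suc (suc zero)) = refl
p32-sym (suc (suc zero)) (suc (suc (suc zero))) = refl
p32-sym (suc (suc zero)) (suc (suc (suc (suc zero)))) = refl
p32-sym (suc (suc (suc zero))) zero = refl
p32-sym (suc (suc (suc zero))) (suc zero) = refl
p32-sym (suc (suc (suc zero))) (suc (suc zero)) = refl
p32-sym (suc (suc (suc zero))) (suc (suc (suc zero))) = refl
p32-sym (suc (suc (suc zero))) (suc (suc (suc (suc zero)))) = refl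
p32-sym (suc (suc (suc (suc zero)))) zero = refl
p32-sym (suc (suc (suc (suc zero)))) (suc zero) = refl
p32-sym (suc (suc (suc (suc zero)))) (suc (suc zero)) = refl
p32-sym (suc (suc (suc (suc zero)))) (suc (suc (suc zero))) = refl
p32-sym (suc (suc (suc (suc zero)))) (suc (suc (suc (suc zero)))) = refl

p32-irrefl : ∀ u → p32 u u ≡ false
p32-irrefl zero = refl
p32-irrefl (suc zero) = refl
p32-irrefl (suc (suc zero)) = refl
p32-irrefl (suc (suc (suc zero))) = refl
p32-irrefl (suc (suc (suc (suc zero)))) = refl

P3+P2 : Graph
P3+P2 = record { n = 5 ; adj = p32 ; sym = p32-sym ; irrefl = p32-irrefl }

P3+P2-free : GraphClass
P3+P2-free G = ¬ (P3+P2 ⊑ G)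

_⊆ᶜ_ : GraphClass → GraphClass → Set
𝒳 ⊆ᶜ 𝒴 = ∀ G → 𝒳 G → 𝒴 G

-- The extension G' of G: vertices Fin (2 + n); zero is x, suc zero is y,
-- suc (suc v) is the old vertex v.  The partition label of a vertex in A
-- is lab v : Fin 3  (zero ↦ A1, suc zero ↦ A2, suc (suc zero) ↦ A3).
-- x is adjacent to A1 ∪ A3, y is adjacent to A2 ∪ A3, and x, y are non-adjacent.
inX : Fin 3 → Bool
inX zero = true
inX (suc zero) = false
inX (suc (suc zero)) = true

inY : Fin 3 → Bool
inY zero = false
inY (suc zero) = true
inY (suc (suc zero)) = true

module _ (G : Graph) (inA : Fin (n G) → Bool) (lab : Fin (n G) → Fin 3) where

  extAdj : Fin (suc (suc (n G))) → Fin (suc (suc (n G))) → Bool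
  extAdj zero zero = false
  extAdj zero (suc zero) = false
  extAdj zero (suc (suc v)) = inA v ∧ inX (lab v)
  extAdj (suc zero) zero = false
  extAdj (suc zero) (suc zero) = false
  extAdj (suc zero) (suc (suc v)) = inA v ∧ inY (lab v)
  extAdj (suc (suc u)) zero = inA u ∧ inX (lab u)
  extAdj (suc (suc u)) (suc zero) = inA u ∧ inY (lab u)
  extAdj (suc (suc u)) (suc (suc v)) = adj G u v

  extAdj-sym : ∀ u v → extAdj u v ≡ extAdj v u
  extAdj-sym zero zero = refl
  extAdj-sym zero (suc zero) = refl
  extAdj-sym zero (suc (suc v)) = refl
  extAdj-sym (suc zero) zero = refl
  extAdj-sym (suc zero) (suc zero) = refl
  extAdj-sym (suc zero) (suc (suc v)) = refl
  extAdj-sym (suc (suc u)) zero = refl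
  extAdj-sym (suc (suc u)) (suc zero) = refl
  extAdj-sym (suc (suc u)) (suc (suc v)) = sym G u v

  extAdj-irrefl : ∀ u → extAdj u u ≡ false
  extAdj-irrefl zero = refl
  extAdj-irrefl (suc zero) = refl
  extAdj-irrefl (suc (suc u)) = irrefl G u

  extend : Graph
  extend = record { n = suc (suc (n G)) ; adj = extAdj
                  ; sym = extAdj-sym ; irrefl = extAdj-irrefl }

-- G(A,B) with A = {v | inA v ≡ true}, B = {v | inA v ≡ false}.
record Irreducible (𝒳 : GraphClass) (G : Graph) (inA : Fin (n G) → Bool) : Set where
  field
    inClass      : 𝒳 G
    B-indep      : ∀ u v → inA u ≡ false → inA v ≡ false → adj G u v ≡ false
    B-no-deg1    : ∀ b → inA b ≡ false →
                   ¬ (Σ (Fin (n G)) λ w → adj G b w ≡ true ×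
                        (∀ w' → adj G b w' ≡ true → w' ≡ w))
    A-no-domin   : ∀ u v → inA u ≡ true → inA v ≡ true → u ≢ v →
                   ¬ (∀ b → inA b ≡ false → adj G u b ≡ true → adj G v b ≡ true)
    B-not-full   : ∀ b → inA b ≡ false →
                   ¬ (∀ a → inA a ≡ true → adj G b a ≡ true)
    extension    : Σ (Fin (n G) → Fin 3) λ lab → 𝒳 (extend G inA lab)

NB-covered : (G : Graph) (inA : Fin (n G) → Bool) (a3 a1 a2 : Fin (n G)) → Set
NB-covered G inA a3 a1 a2 =
  ∀ b → inA b ≡ false → adj G a3 b ≡ true → adj G a1 b ≡ true ⊎ adj G a2 b ≡ true

Dominates : (G : Graph) (inA : Fin (n G) → Bool) (D : Fin (n G) → Bool) → Set
Dominates G inA D =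
  ∀ b → inA b ≡ false → Σ (Fin (n G)) λ d → D d ≡ true × adj G b d ≡ true

SubsetOf : ∀ {m} → (Fin m → Bool) → (Fin m → Bool) → Set
SubsetOf {m} S T = ∀ v → S v ≡ true → T v ≡ true

MinimalDominating : (G : Graph) (inA : Fin (n G) → Bool) (D : Fin (n G) → Bool) → Set
MinimalDominating G inA D =
  SubsetOf D inA × Dominates G inA D ×
  (∀ D' → SubsetOf D' D → Dominates G inA D' → SubsetOf D D')

-- G[D] is complete multipartite: the vertices of D are partitioned into parts
-- (fibres of `part`) such that two distinct vertices of D are adjacent iff
-- they lie in different parts (so parts are independent, and all edges between
-- different parts are present).
CompleteMultipartiteOn : (G : Graph) (D : Fin (n G) → Bool) → Set
CompleteMultipartiteOn G D =
  Σ (Fin (n G) → Fin (n G)) λ part →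
    ∀ u v → D u ≡ true → D v ≡ true → u ≢ v →
      (adj G u v ≡ true → part u ≢ part v) × (part u ≢ part v → adj G u v ≡ true)

-- Part 1 uses only that G is (P₃+P₂)-free, that B is independent, and that
-- no vertex of A dominates another one on B: the latter yields, for
-- distinct a, a' ∈ A, a "private neighbour" b ∈ B of a that misses a'.
-- If b ∈ N_B(a₃) avoided both a₁ and a₂, then with private neighbours
-- b₁ of a₁ (missing a₃) and b₂ of a₁ (missing a₂) one of
-- b₁–a₁–a₂ + a₃–b,  b₂–a₁–a₂ + a₃–b,  b–a₃–b₂ + a₂–b₁
-- would be an induced P₃+P₂.
--
-- Part 2: in an inclusion-minimal dominating set D no member w can have its
-- B-neighbourhood covered by two other members (D ∖ w would still
-- dominate).  By Part 1, G[D] therefore contains no induced K₂+K₁, so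
-- non-adjacency is an equivalence relation on D, whose classes are the
-- parts of a complete multipartite graph; each vertex is mapped to the
-- first vertex of its class.

module Submission where

open import Defs hiding (sym)
open import Data.Nat using (zero; suc)
open import Data.Fin using (Fin; zero; suc; _≟_)
open import Data.Fin.Properties using (¬∀⟶∃¬)
open import Data.Bool using (Bool; true; false; _∧_; not; if_then_else_)
import Data.Bool.Properties as Bool
open import Data.Maybe using (Maybe; just; nothing; fromMaybe)
import Data.Maybe as Maybe
open import Data.Vec using ([]; _∷_; lookup)
open import Data.Vec.Relation.Unary.All using ([]; _∷_)
open import Data.Vec.Relation.Unary.AllPairs using ([]; _∷_)
open import Data.Vec.Relation.Unary.Unique.Propositional.Properties using (lookup-injective)
open import Data.Product using (Σ; _×_; _,_)
open import Data.Sum using (inj₁; inj₂)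
open import Data.Empty using (⊥; ⊥-elim)
open import Function using (_∘_)
open import Relation.Nullary using (¬_; yes; no)
open import Relation.Nullary.Decidable using (_→-dec_; ⌊_⌋)
open import Relation.Binary.PropositionalEquality

module Adjacency (G : Graph) where

  adj-sym : ∀ {u v b} → adj G u v ≡ b → adj G v u ≡ b
  adj-sym {u} {v} p = trans (Graph.sym G v u) p

  edge⇒≢ : ∀ {u v} → adj G u v ≡ true → u ≢ v
  edge⇒≢ {u} p refl with trans (sym p) (irrefl G u)
  ... | ()

  separated : ∀ {w u v} → adj G w u ≡ true → adj G w v ≡ false → u ≢ v
  separated p q refl with trans (sym p) q
  ... | ()

open Adjacency

label-separates : ∀ {m} (inA : Fin m → Bool) {u v} → inA u ≡ false → inA v ≡ true → u ≢ v
label-separates inA p q refl with trans (sym q) p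
... | ()

-- Distinctness follows from the adjacencies, except for
-- v₀ ≢ v₂ (both ends of the P₃ have the same neighbourhood), which is assumed.
induced-P3+P2 : (G : Graph) (v₀ v₁ v₂ v₃ v₄ : Fin (n G)) →
  adj G v₀ v₁ ≡ true → adj G v₁ v₂ ≡ true → adj G v₃ v₄ ≡ true →
  adj G v₀ v₂ ≡ false → adj G v₀ v₃ ≡ false → adj G v₀ v₄ ≡ false →
  adj G v₁ v₃ ≡ false → adj G v₁ v₄ ≡ false → adj G v₂ v₃ ≡ false →
  adj G v₂ v₄ ≡ false → v₀ ≢ v₂ → P3+P2 ⊑ G
induced-P3+P2 G v₀ v₁ v₂ v₃ v₄ e01 e12 e34 n02 n03 n04 n13 n14 n23 n24 v₀≢v₂ =
  record { emb = lookup vertices ; inj = λ {i} {j} → lookup-injective distinct i j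
         ; adj-pres = preserved }
  where
    vertices = v₀ ∷ v₁ ∷ v₂ ∷ v₃ ∷ v₄ ∷ []

    distinct =
      (edge⇒≢ G e01 ∷ v₀≢v₂ ∷ separated G (adj-sym G e01) n13
        ∷ separated G (adj-sym G e01) n14 ∷ [])
      ∷ (edge⇒≢ G e12 ∷ separated G e01 n03 ∷ separated G e01 n04 ∷ [])
      ∷ (separated G e12 n13 ∷ separated G e12 n14 ∷ [])
      ∷ (edge⇒≢ G e34 ∷ [])
      ∷ [] ∷ []

    preserved : ∀ i j → p32 i j ≡ adj G (lookup vertices i) (lookup vertices j)
    preserved zero zero = sym (irrefl G v₀)
    preserved zero (suc zero) = sym e01
    preserved zero (suc (suc zero)) = sym n02
    preserved zero (suc (suc (suc zero))) = sym n03
    preserved zero (suc (suc (suc (suc zero)))) = sym n04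
    preserved (suc zero) zero = sym (adj-sym G e01)
    preserved (suc zero) (suc zero) = sym (irrefl G v₁)
    preserved (suc zero) (suc (suc zero)) = sym e12
    preserved (suc zero) (suc (suc (suc zero))) = sym n13
    preserved (suc zero) (suc (suc (suc (suc zero)))) = sym n14
    preserved (suc (suc zero)) zero = sym (adj-sym G n02)
    preserved (suc (suc zero)) (suc zero) = sym (adj-sym G e12)
    preserved (suc (suc zero)) (suc (suc zero)) = sym (irrefl G v₂)
    preserved (suc (suc zero)) (suc (suc (suc zero))) = sym n23
    preserved (suc (suc zero)) (suc (suc (suc (suc zero)))) = sym n24
    preserved (suc (suc (suc zero))) zero = sym (adj-sym G n03)
    preserved (suc (suc (suc zero))) (suc zero) = sym (adj-sym G n13)
    preserved (suc (suc (suc zero))) (suc (suc zero)) = sym (adj-sym G n23)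
    preserved (suc (suc (suc zero))) (suc (suc (suc zero))) = sym (irrefl G v₃)
    preserved (suc (suc (suc zero))) (suc (suc (suc (suc zero)))) = sym e34
    preserved (suc (suc (suc (suc zero)))) zero = sym (adj-sym G n04)
    preserved (suc (suc (suc (suc zero)))) (suc zero) = sym (adj-sym G n14)
    preserved (suc (suc (suc (suc zero)))) (suc (suc zero)) = sym (adj-sym G n24)
    preserved (suc (suc (suc (suc zero)))) (suc (suc (suc zero))) = sym (adj-sym G e34)
    preserved (suc (suc (suc (suc zero)))) (suc (suc (suc (suc zero)))) = sym (irrefl G v₄)

PrivateNeighbour : (G : Graph) (inA : Fin (n G) → Bool) (a a' : Fin (n G)) → Set
PrivateNeighbour G inA a a' =
  Σ (Fin (n G)) λ b → inA b ≡ false × adj G a b ≡ true × adj G a' b ≡ false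

-- If N_B(a) ⊈ N_B(a') then a has a private neighbour missing a'
-- (a counterexample can be found by search, the vertex set being finite).
private-neighbour : (G : Graph) (inA : Fin (n G) → Bool) (a a' : Fin (n G)) →
  ¬ (∀ b → inA b ≡ false → adj G a b ≡ true → adj G a' b ≡ true) →
  PrivateNeighbour G inA a a'
private-neighbour G inA a a' ¬dominated
  with ¬∀⟶∃¬ (n G) _
         (λ b → inA b Bool.≟ false →-dec adj G a b Bool.≟ true →-dec adj G a' b Bool.≟ true)
         ¬dominated
... | b , ¬implication = b , counterexample ¬implication
  where
    counterexample : ∀ {x y z} → ¬ (x ≡ false → y ≡ true → z ≡ true) →
                     x ≡ false × y ≡ true × z ≡ false
    counterexample {false} {true} {false} _ = refl , refl , refl
    counterexample {false} {true} {true} ¬i = ⊥-elim (¬i λ _ _ → refl)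
    counterexample {false} {false} ¬i = ⊥-elim (¬i λ _ ())
    counterexample {true} ¬i = ⊥-elim (¬i λ ())

covering : (G : Graph) (inA : Fin (n G) → Bool) → P3+P2-free G →
  (∀ u v → inA u ≡ false → inA v ≡ false → adj G u v ≡ false) →
  (∀ u v → inA u ≡ true → inA v ≡ true → u ≢ v →
     ¬ (∀ b → inA b ≡ false → adj G u b ≡ true → adj G v b ≡ true)) →
  (a₁ a₂ a₃ : Fin (n G)) → inA a₁ ≡ true → inA a₂ ≡ true → inA a₃ ≡ true →
  adj G a₁ a₂ ≡ true → adj G a₁ a₃ ≡ false → adj G a₂ a₃ ≡ false →
  NB-covered G inA a₃ a₁ a₂
covering G inA free B-indep no-domination a₁ a₂ a₃ i₁ i₂ i₃ e12 n13 n23 b ib e3b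
  with adj G a₁ b in n1b | adj G a₂ b in n2b
... | true | _ = inj₁ refl
... | false | true = inj₂ refl
... | false | false =
  ⊥-elim (impossible (private-nbr a₁ a₃ i₁ i₃ (separated G (adj-sym G e12) n23))
                     (private-nbr a₁ a₂ i₁ i₂ (edge⇒≢ G e12)))
  where
    private-nbr : ∀ a a' → inA a ≡ true → inA a' ≡ true → a ≢ a' → PrivateNeighbour G inA a a'
    private-nbr a a' i i' a≢a' = private-neighbour G inA a a' (no-domination a a' i i' a≢a')

    -- A vertex c ∈ B seeing a₁ but neither a₂ nor a₃ gives c–a₁–a₂ + a₃–b.
    pendant : ∀ c → inA c ≡ false → adj G a₁ c ≡ true → adj G a₂ c ≡ false →
              adj G a₃ c ≡ false → ⊥
    pendant c ic e1c n2c n3c =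
      free (induced-P3+P2 G c a₁ a₂ a₃ b (adj-sym G e1c) e12 e3b (adj-sym G n2c)
              (adj-sym G n3c) (B-indep c b ic ib) n13 n1b n23 n2b
              (label-separates inA ic i₂))

    impossible : PrivateNeighbour G inA a₁ a₃ → PrivateNeighbour G inA a₁ a₂ → ⊥
    impossible (b₁ , ib₁ , e1b₁ , n3b₁) (b₂ , ib₂ , e1b₂ , n2b₂)
      with adj G a₂ b₁ in e2b₁ | adj G a₃ b₂ in e3b₂
    ... | false | _ = pendant b₁ ib₁ e1b₁ e2b₁ n3b₁
    ... | true | false = pendant b₂ ib₂ e1b₂ n2b₂ e3b₂
    ... | true | true =
      free (induced-P3+P2 G b a₃ b₂ a₂ b₁ (adj-sym G e3b) e3b₂ e2b₁ (B-indep b b₂ ib ib₂)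
              (adj-sym G n2b) (B-indep b b₁ ib ib₁) (adj-sym G n23) n3b₁ (adj-sym G n2b₂)
              (B-indep b₂ b₁ ib₂ ib₁) (≢-sym (separated G e1b₂ n1b)))

first : ∀ {m} → (Fin m → Bool) → Maybe (Fin m)
first {zero} P = nothing
first {suc m} P = if P zero then just zero else Maybe.map suc (first (P ∘ suc))

first-cong : ∀ {m} (P Q : Fin m → Bool) → (∀ t → P t ≡ Q t) → first P ≡ first Q
first-cong {zero} P Q eq = refl
first-cong {suc m} P Q eq =
  cong₂ (λ b r → if b then just zero else r) (eq zero)
        (cong (Maybe.map suc) (first-cong (P ∘ suc) (Q ∘ suc) (eq ∘ suc)))

first-sound : ∀ {m} (P : Fin m → Bool) {t} → first P ≡ just t → P t ≡ true
first-sound {suc m} P found with P zero in P₀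
first-sound {suc m} P refl | true = P₀
first-sound {suc m} P found | false with first (P ∘ suc) in rest
first-sound {suc m} P refl | false | just t = first-sound (P ∘ suc) rest

first-exists : ∀ {m} (P : Fin m → Bool) t → P t ≡ true → Σ (Fin m) λ t' → first P ≡ just t'
first-exists P zero P₀ rewrite P₀ = zero , refl
first-exists P (suc t) Pt with P zero
... | true = zero , refl
... | false with first-exists (P ∘ suc) t Pt
...   | t' , found = suc t' , cong (Maybe.map suc) found

K2+K1-free : (G : Graph) → (Fin (n G) → Bool) → Set
K2+K1-free G S = ∀ u v w → S u ≡ true → S v ≡ true → S w ≡ true →
  adj G u v ≡ true → adj G u w ≡ false → adj G v w ≡ false → ⊥

-- In a K₂+K₁-free G[S] non-adjacency is an equivalence relation on S, so
-- G[S] is complete multipartite; the part of u is the first vertex of S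
-- not adjacent to u (u itself qualifies, so it exists).
complete-multipartite : (G : Graph) (S : Fin (n G) → Bool) → K2+K1-free G S →
  CompleteMultipartiteOn G S
complete-multipartite G S free = part , λ u v su sv _ →
  (λ uv same → different-parts u v su sv uv same) , same-part-or-adjacent u v su sv
  where
    nonNeighbour : Fin (n G) → Fin (n G) → Bool
    nonNeighbour u t = S t ∧ not (adj G u t)

    part : Fin (n G) → Fin (n G)
    part u = fromMaybe u (first (nonNeighbour u))

    self : ∀ u → S u ≡ true → nonNeighbour u u ≡ true
    self u su rewrite su | irrefl G u = refl

    part-spec : ∀ u → S u ≡ true → S (part u) ≡ true × adj G u (part u) ≡ false
    part-spec u su with first-exists (nonNeighbour u) u (self u su)
    ... | t , found rewrite found = ∧-not (first-sound (nonNeighbour u) found)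
      where
        ∧-not : ∀ {x y} → x ∧ not y ≡ true → x ≡ true × y ≡ false
        ∧-not {true} {false} _ = refl , refl

    same-nonNeighbours : ∀ u v → S u ≡ true → S v ≡ true → adj G u v ≡ false →
                         ∀ t → nonNeighbour u t ≡ nonNeighbour v t
    same-nonNeighbours u v su sv nuv t with S t in st
    ... | false = refl
    ... | true with adj G u t in ut | adj G v t in vt
    ...   | false | false = refl
    ...   | true | true = refl
    ...   | false | true = ⊥-elim (free v t u sv st su vt (adj-sym G nuv) (adj-sym G ut))
    ...   | true | false = ⊥-elim (free u t v su st sv ut nuv (adj-sym G vt))

    different-parts : ∀ u v → S u ≡ true → S v ≡ true → adj G u v ≡ true →
                      part u ≡ part v → ⊥
    different-parts u v su sv uv same with part-spec u su | part-spec v sv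
    ... | sp , up | _ , vp = free u v (part u) su sv sp uv up (subst (λ p → adj G v p ≡ false) (sym same) vp)

    same-part-or-adjacent : ∀ u v → S u ≡ true → S v ≡ true → part u ≢ part v →
                            adj G u v ≡ true
    same-part-or-adjacent u v su sv distinct with adj G u v in uv
    ... | true = refl
    ... | false with first-exists (nonNeighbour v) v (self v sv)
    ...   | t , found = ⊥-elim (distinct (begin
      fromMaybe u (first (nonNeighbour u))
        ≡⟨ cong (fromMaybe u) (trans (first-cong _ _ (same-nonNeighbours u v su sv uv)) found) ⟩
      t
        ≡⟨ cong (fromMaybe v) found ⟨
      fromMaybe v (first (nonNeighbour v)) ∎))
      where open ≡-Reasoning

_∖_ : ∀ {m} → (Fin m → Bool) → Fin m → (Fin m → Bool)
(D ∖ w) t = D t ∧ not ⌊ t ≟ w ⌋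

∖-⊆ : ∀ {m} (D : Fin m → Bool) w → SubsetOf (D ∖ w) D
∖-⊆ D w t p with D t
... | true = refl
... | false = p

∖-removes : ∀ {m} (D : Fin m → Bool) w → (D ∖ w) w ≡ false
∖-removes D w with w ≟ w
... | yes _ = Bool.∧-zeroʳ (D w)
... | no w≢w = ⊥-elim (w≢w refl)

∖-keeps : ∀ {m} (D : Fin m → Bool) {w t} → D t ≡ true → t ≢ w → (D ∖ w) t ≡ true
∖-keeps D {w} {t} dt t≢w with t ≟ w
... | yes t≡w = ⊥-elim (t≢w t≡w)
... | no _ rewrite dt = refl

-- In an inclusion-minimal dominating set, no member w has its B-neighbourhood
-- covered by two other members u, v: otherwise D ∖ w still dominates B.
minimal-irredundant : (G : Graph) (inA : Fin (n G) → Bool) (D : Fin (n G) → Bool) →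
  MinimalDominating G inA D → ∀ u v w → D u ≡ true → D v ≡ true → D w ≡ true →
  u ≢ w → v ≢ w → NB-covered G inA w u v → ⊥
minimal-irredundant G inA D (_ , dominates , minimal) u v w du dv dw u≢w v≢w covered
  with trans (sym (minimal (D ∖ w) (∖-⊆ D w) still-dominates w dw)) (∖-removes D w)
  where
    still-dominates : Dominates G inA (D ∖ w)
    still-dominates b ib with dominates b ib
    ... | d , dd , bd with d ≟ w
    ...   | no d≢w = d , ∖-keeps D dd d≢w , bd
    ...   | yes refl with covered b ib (adj-sym G bd)
    ...     | inj₁ ub = u , ∖-keeps D du u≢w , adj-sym G ub
    ...     | inj₂ vb = v , ∖-keeps D dv v≢w , adj-sym G vb
... | ()

minimal-dominating-K2+K1-free : (G : Graph) (inA : Fin (n G) → Bool) →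
  ((a₁ a₂ a₃ : Fin (n G)) → inA a₁ ≡ true → inA a₂ ≡ true → inA a₃ ≡ true →
     adj G a₁ a₂ ≡ true → adj G a₁ a₃ ≡ false → adj G a₂ a₃ ≡ false →
     NB-covered G inA a₃ a₁ a₂) →
  (D : Fin (n G) → Bool) → MinimalDominating G inA D → K2+K1-free G D
minimal-dominating-K2+K1-free G inA cover D md@(D⊆A , _) u v w du dv dw uv nuw nvw =
  minimal-irredundant G inA D md u v w du dv dw
    (separated G (adj-sym G uv) nvw) (separated G uv nuw)
    (cover u v w (D⊆A u du) (D⊆A v dv) (D⊆A w dw) uv nuw nvw)

lemma5 : (𝒳 : GraphClass) → Hereditary 𝒳 → 𝒳 ⊆ᶜ P3+P2-free →
    (G : Graph) (inA : Fin (n G) → Bool) → Irreducible 𝒳 G inA →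
    ((a1 a2 a3 : Fin (n G)) →
    inA a1 ≡ true → inA a2 ≡ true → inA a3 ≡ true →
    adj G a1 a2 ≡ true → adj G a1 a3 ≡ false → adj G a2 a3 ≡ false →
    NB-covered G inA a3 a1 a2)
    ×
    ((D : Fin (n G) → Bool) → MinimalDominating G inA D →
    CompleteMultipartiteOn G D)
lemma5 𝒳 _ 𝒳⊆free G inA irreducible = cover , multipartite
  where
    open Irreducible irreducible
    cover = covering G inA (𝒳⊆free G inClass) B-indep A-no-domin
    multipartite = λ D md →
      complete-multipartite G D (minimal-dominating-K2+K1-free G inA cover D md)
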